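{- Let $G$ be a connected finite simple graph with minimum degree $\delta(G)\ge 2$, maximum degree $\Delta(G)$, and girth at least $7$. Then $C_{tr}(G)\ge \Delta(G)+1$.
   Context: A set $S\subseteq V$ is a total restrained dominating set (TRD-set) of $G=(V,E)$ if every vertex of $V\setminus S$ is adjacent to at least one vertex of $S$ and to at least one other vertex of $V\setminus S$, and every vertex of $S$ is adjacent to at least one other vertex of $S$. Two disjoint sets $X,Y\subseteq V$ form a total restrained coalition if neither is a TRD-set but $X\cup Y$ is a TRD-set. A trc-partition of $G$ is a partition $\Phi$ of $V$ such that no member of $\Phi$ is a TRD-set and each member forms a total restrained coalition with some other member of $\Phi$. $C_{tr}(G)$ is the maximum cardinality of a trc-partition of $G$. -}

module Defs where

open import Data.Nat using (ℕ; zero; suc; _≤_; _<_; _⊔_; _+_)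
open import Data.Fin using (Fin; zero; suc; inject₁; fromℕ)
open import Data.Fin.Subset using (Subset; ∣_∣)
open import Data.Vec using (tabulate)
open import Data.Bool using (Bool; true; false)
open import Data.List using (List; foldr; map; allFin)
open import Data.Product using (Σ; ∃; _×_; _,_)
open import Data.Sum using (_⊎_)
open import Data.Empty using (⊥)
open import Relation.Nullary using (¬_)
open import Relation.Binary.PropositionalEquality using (_≡_; _≢_)
open import Relation.Binary.Construct.Closure.ReflexiveTransitive using (Star)
open import Function.Definitions using (Injective; Surjective)

record Graph (n : ℕ) : Set where
  field
    adj       : Fin n → Fin n → Bool
    adj-sym   : ∀ u v → adj u v ≡ adj v u
    adj-irrefl : ∀ v → adj v v ≡ false

module _ {n : ℕ} (G : Graph n) where
  open Graph G

  Adj : Fin n → Fin n → Set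
  Adj u v = adj u v ≡ true

  degree : Fin n → ℕ
  degree v = ∣ tabulate (adj v) ∣

  -- maximum degree Δ(G) (0 for the empty graph)
  maxDegree : ℕ
  maxDegree = foldr _⊔_ 0 (map degree (allFin n))

  MinDegreeAtLeast : ℕ → Set
  MinDegreeAtLeast k = ∀ v → k ≤ degree v

  Connected : Set
  Connected = (0 < n) × (∀ u v → Star Adj u v)

  Cycle : ℕ → Set
  Cycle zero = ⊥
  Cycle (suc m) =
    Σ (Fin (suc m) → Fin n) λ c →
      Injective _≡_ _≡_ c
      × (∀ (i : Fin m) → Adj (c (inject₁ i)) (c (suc i)))
      × Adj (c (fromℕ m)) (c zero)

  GirthAtLeast : ℕ → Set
  GirthAtLeast g = ∀ k → 3 ≤ k → k < g → ¬ Cycle k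

  IsTRD : (Fin n → Set) → Set
  IsTRD S =
    (∀ v → ¬ S v → (∃ λ u → S u × Adj v u) × (∃ λ u → ¬ S u × Adj v u))
    × (∀ v → S v → ∃ λ u → S u × Adj v u)

  -- a partition of V into k (nonempty) classes, given by a surjective
  -- class map f; class j is { v | f v ≡ j }
  IsTrcPartition : (k : ℕ) → (Fin n → Fin k) → Set
  IsTrcPartition k f =
    Surjective _≡_ _≡_ f
    × (∀ j → ¬ IsTRD (λ v → f v ≡ j))
    × (∀ j → ∃ λ j′ → j′ ≢ j × IsTRD (λ v → f v ≡ j ⊎ f v ≡ j′))

  -- C_tr(G) ≥ m, i.e. the maximum size of a trc-partition is at least m
  CtrAtLeast : ℕ → Set
  CtrAtLeast m = ∃ λ k → m ≤ k × Σ (Fin n → Fin k) (IsTrcPartition k)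

-- Let v be a vertex of maximum degree Δ, with neighbours u₀, …, u_{Δ-1}. The classes are
-- the Δ branches Bᵢ = N[uᵢ] ∖ {v} and the rest R, which contains v; girth ≥ 5 makes the
-- branches disjoint. No class is a TRD-set: v has no neighbour in R, and a neighbour of
-- u_j (j ≠ i) in Bᵢ would also lie in B_j. Each Bᵢ ∪ R is a TRD-set because girth ≥ 7
-- keeps the branches apart: a neighbour of a second-level vertex of B_j other than u_j
-- lies in R (else a cycle of length 3, 4 or 5 through v), and a vertex of R ∖ {v} has a
-- neighbour in R (two neighbours in branches would close a cycle of length 4 or 6).
module Submission where

open import Defs
open import Data.Bool as Bool using (true)
open import Data.Empty using (⊥; ⊥-elim)
open import Data.Fin using (Fin; zero; suc; inject₁; fromℕ; fromℕ<; _≟_)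
open import Data.Fin.Properties using (any?; suc-injective)
open import Data.Fin.Subset using (Subset; ∣_∣; _∈_; inside; outside)
open import Data.List as List using (List; []; _∷_; foldr; map; length)
open import Data.List.Membership.Propositional.Properties using (∈-lookup)
open import Data.List.Relation.Unary.All as All using ([]; _∷_)
open import Data.List.Relation.Unary.AllPairs using ([]; _∷_)
open import Data.List.Relation.Unary.Linked using (Linked; [-]; _∷_)
open import Data.List.Relation.Unary.Unique.Propositional using (Unique)
open import Data.Nat using (ℕ; suc; _+_; _≤_; _<_; _⊔_; z≤n; s≤s; _≤?_; _<?_)
open import Data.Nat.Properties using (≤-refl; ≤-reflexive; ≤-trans; ≤-total; ⊔-lub; +-comm)
open import Data.Product using (∃; ∃₂; _×_; _,_; proj₁)
open import Data.Sum using (_⊎_; inj₁; inj₂; [_,_]; swap)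
open import Data.Sum.Function.Propositional using (_⊎-⇔_)
open import Data.Vec using ([]; _∷_; tabulate; here; there)
open import Data.Vec.Properties using ([]=⇒lookup; lookup⇒[]=; lookup∘tabulate)
open import Function using (_∘_; const)
open import Function.Bundles using (_⇔_; mk⇔; Equivalence)
import Function.Properties.Equivalence as ⇔
open import Function.Definitions using (Injective; Surjective)
open import Relation.Nullary using (¬_; Dec; yes; no)
open import Relation.Nullary.Decidable using (True; toWitness; _⊎-dec_; _×-dec_; ¬?)
open import Relation.Binary.PropositionalEquality using (_≡_; _≢_; refl; sym; trans; cong; ≢-sym)

open Equivalence using (to; from)

max-attained : ∀ {A : Set} (f : A → ℕ) (x : A) (xs : List A) →
               ∃ λ y → foldr _⊔_ 0 (map f (x ∷ xs)) ≤ f y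
max-attained f x [] = x , ⊔-lub ≤-refl z≤n
max-attained f x (x′ ∷ xs) with max-attained f x′ xs
... | y , max≤fy with ≤-total (f x) (f y)
...   | inj₁ fx≤fy = y , ⊔-lub fx≤fy max≤fy
...   | inj₂ fy≤fx = x , ⊔-lub ≤-refl (≤-trans max≤fy fy≤fx)

another-index : ∀ {k} → 2 ≤ k → (i : Fin k) → ∃ λ j → j ≢ i
another-index (s≤s (s≤s _)) zero    = suc zero , λ ()
another-index (s≤s (s≤s _)) (suc i) = zero , λ ()

lookup-injective : ∀ {A : Set} {xs : List A} → Unique xs → Injective _≡_ _≡_ (List.lookup xs)
lookup-injective (_ ∷ _)     {zero}  {zero}  _  = refl
lookup-injective (x∉xs ∷ _)  {zero}  {suc j} eq = ⊥-elim (All.lookup x∉xs (∈-lookup j) eq)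
lookup-injective (x∉xs ∷ _)  {suc i} {zero}  eq = ⊥-elim (All.lookup x∉xs (∈-lookup i) (sym eq))
lookup-injective (_ ∷ uniq)  {suc i} {suc j} eq = cong suc (lookup-injective uniq eq)

Linked-lookup : ∀ {A : Set} {R : A → A → Set} {x : A} {xs : List A} → Linked R (x ∷ xs) →
                ∀ (i : Fin (length xs)) → R (List.lookup (x ∷ xs) (inject₁ i)) (List.lookup (x ∷ xs) (suc i))
Linked-lookup (r ∷ _)  zero    = r
Linked-lookup (_ ∷ rs) (suc i) = Linked-lookup rs i

record Enumeration {n : ℕ} (P : Fin n → Set) (k : ℕ) : Set where
  field
    elem      : Fin k → Fin n
    injective : Injective _≡_ _≡_ elem
    sound     : ∀ i → P (elem i)
    complete  : ∀ {x} → P x → ∃ λ i → elem i ≡ x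

Enumeration-distinct : ∀ {n k} {P : Fin n → Set} → Enumeration P k → 2 ≤ k →
                       ∃₂ λ x y → P x × P y × x ≢ y
Enumeration-distinct e (s≤s (s≤s _)) =
  elem zero , elem (suc zero) , sound zero , sound (suc zero) , (λ ()) ∘ injective
  where open Enumeration e

subset-enumeration : ∀ {n} (p : Subset n) → Enumeration (_∈ p) ∣ p ∣
subset-enumeration [] = record
  { elem = λ () ; injective = λ { {()} } ; sound = λ () ; complete = λ { {()} } }
subset-enumeration (outside ∷ p) = record
  { elem = suc ∘ elem ; injective = injective ∘ suc-injective ; sound = there ∘ sound ; complete = complete′ }
  where
  open Enumeration (subset-enumeration p)
  complete′ : ∀ {x} → x ∈ outside ∷ p → ∃ λ i → suc (elem i) ≡ x
  complete′ (there x∈p) with complete x∈p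
  ... | i , refl = i , refl
subset-enumeration (inside ∷ p) = record
  { elem = elem′ ; injective = injective′ ; sound = sound′ ; complete = complete′ }
  where
  open Enumeration (subset-enumeration p)
  elem′ : Fin (suc ∣ p ∣) → Fin (suc _)
  elem′ zero    = zero
  elem′ (suc i) = suc (elem i)
  injective′ : Injective _≡_ _≡_ elem′
  injective′ {zero}  {zero}  _  = refl
  injective′ {suc i} {suc j} eq = cong suc (injective (suc-injective eq))
  sound′ : ∀ i → elem′ i ∈ inside ∷ p
  sound′ zero    = here
  sound′ (suc i) = there (sound i)
  complete′ : ∀ {x} → x ∈ inside ∷ p → ∃ λ i → elem′ i ≡ x
  complete′ here = zero , refl
  complete′ (there x∈p) with complete x∈p
  ... | i , refl = suc i , refl

maxDegree-attained : ∀ {n} (G : Graph n) → 0 < n → ∃ λ v → maxDegree G ≤ degree G v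
-- allFin (suc m) reduces to zero ∷ List.tabulate suc.
maxDegree-attained {suc _} G _ = max-attained (degree G) zero (List.tabulate suc)

IsTRD-resp : ∀ {n} (G : Graph n) {P Q : Fin n → Set} → (∀ x → P x ⇔ Q x) → IsTRD G P → IsTRD G Q
IsTRD-resp G {Q = Q} P⇔Q (dominated , total) = dominated′ , total′
  where
  dominated′ : ∀ x → ¬ Q x → (∃ λ y → Q y × Adj G x y) × (∃ λ z → ¬ Q z × Adj G x z)
  dominated′ x ¬Qx with dominated x (¬Qx ∘ to (P⇔Q x))
  ... | (y , Py , xy) , (z , ¬Pz , xz) = (y , to (P⇔Q y) Py , xy) , (z , ¬Pz ∘ from (P⇔Q z) , xz)
  total′ : ∀ x → Q x → ∃ λ y → Q y × Adj G x y
  total′ x Qx with total x (from (P⇔Q x) Qx)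
  ... | y , Py , xy = y , to (P⇔Q y) Py , xy

IsTRD-cong : ∀ {n} (G : Graph n) {P Q : Fin n → Set} → (∀ x → P x ⇔ Q x) → IsTRD G P ⇔ IsTRD G Q
IsTRD-cong G P⇔Q = mk⇔ (IsTRD-resp G P⇔Q) (IsTRD-resp G (⇔.sym ∘ P⇔Q))

module _ {n : ℕ} (G : Graph n) where
  open Graph G

  infix 4 _∼_
  _∼_ : Fin n → Fin n → Set
  _∼_ = Adj G

  ∼-sym : ∀ {x y} → x ∼ y → y ∼ x
  ∼-sym {x} {y} x∼y = trans (adj-sym y x) x∼y

  ∼⇒≢ : ∀ {x y} → x ∼ y → x ≢ y
  ∼⇒≢ {x} x∼x refl with trans (sym x∼x) (adj-irrefl x)
  ... | ()

  neighbourhood : ∀ x → Enumeration (x ∼_) (degree G x)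
  neighbourhood x = record
    { elem = elem ; injective = injective ; sound = ∈⇒∼ ∘ sound ; complete = complete ∘ ∼⇒∈ }
    where
    open Enumeration (subset-enumeration (tabulate (adj x)))
    ∈⇒∼ : ∀ {y} → y ∈ tabulate (adj x) → x ∼ y
    ∈⇒∼ {y} y∈N = trans (sym (lookup∘tabulate (adj x) y)) ([]=⇒lookup y∈N)
    ∼⇒∈ : ∀ {y} → x ∼ y → y ∈ tabulate (adj x)
    ∼⇒∈ {y} x∼y = lookup⇒[]= y _ (trans (lookup∘tabulate (adj x) y) x∼y)

  another-neighbour : MinDegreeAtLeast G 2 → ∀ x z → ∃ λ y → x ∼ y × y ≢ z
  another-neighbour δ≥2 x z with Enumeration-distinct (neighbourhood x) (δ≥2 x)
  ... | y₁ , y₂ , x∼y₁ , x∼y₂ , y₁≢y₂ with y₁ ≟ z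
  ...   | no y₁≢z    = y₁ , x∼y₁ , y₁≢z
  ...   | yes refl   = y₂ , x∼y₂ , y₁≢y₂ ∘ sym

  closed-path⇒cycle : ∀ x xs → Linked _∼_ (x ∷ xs) → List.lookup (x ∷ xs) (fromℕ (length xs)) ∼ x →
                      Unique (x ∷ xs) → Cycle G (suc (length xs))
  closed-path⇒cycle x xs path closing distinct =
    List.lookup (x ∷ xs) , lookup-injective distinct , Linked-lookup path , closing

  module Girth≥7 (girth : GirthAtLeast G 7) where

    no-short-cycle : ∀ x xs {3≤k : True (3 ≤? suc (length xs))} {k<7 : True (suc (length xs) <? 7)} →
                     Linked _∼_ (x ∷ xs) → List.lookup (x ∷ xs) (fromℕ (length xs)) ∼ x → ¬ Unique (x ∷ xs)
    no-short-cycle x xs {3≤k} {k<7} path closing distinct =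
      girth _ (toWitness 3≤k) (toWitness k<7) (closed-path⇒cycle x xs path closing distinct)

    no-3-cycle : ∀ {a b c} → a ∼ b → b ∼ c → c ∼ a → ⊥
    no-3-cycle ab bc ca = no-short-cycle _ (_ ∷ _ ∷ []) (ab ∷ bc ∷ [-]) ca
      ( (∼⇒≢ ab ∷ ≢-sym (∼⇒≢ ca) ∷ [])
      ∷ (∼⇒≢ bc ∷ [])
      ∷ [] ∷ [])

    no-4-cycle : ∀ {a b c d} → a ∼ b → b ∼ c → c ∼ d → d ∼ a → a ≢ c → b ≢ d → ⊥
    no-4-cycle ab bc cd da a≢c b≢d = no-short-cycle _ (_ ∷ _ ∷ _ ∷ []) (ab ∷ bc ∷ cd ∷ [-]) da
      ( (∼⇒≢ ab ∷ a≢c ∷ ≢-sym (∼⇒≢ da) ∷ [])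
      ∷ (∼⇒≢ bc ∷ b≢d ∷ [])
      ∷ (∼⇒≢ cd ∷ [])
      ∷ [] ∷ [])

    no-5-cycle : ∀ {a b c d e} → a ∼ b → b ∼ c → c ∼ d → d ∼ e → e ∼ a →
                 a ≢ c → a ≢ d → b ≢ d → b ≢ e → c ≢ e → ⊥
    no-5-cycle ab bc cd de ea a≢c a≢d b≢d b≢e c≢e =
      no-short-cycle _ (_ ∷ _ ∷ _ ∷ _ ∷ []) (ab ∷ bc ∷ cd ∷ de ∷ [-]) ea
        ( (∼⇒≢ ab ∷ a≢c ∷ a≢d ∷ ≢-sym (∼⇒≢ ea) ∷ [])
        ∷ (∼⇒≢ bc ∷ b≢d ∷ b≢e ∷ [])
        ∷ (∼⇒≢ cd ∷ c≢e ∷ [])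
        ∷ (∼⇒≢ de ∷ [])
        ∷ [] ∷ [])

    no-6-cycle : ∀ {a b c d e f} → a ∼ b → b ∼ c → c ∼ d → d ∼ e → e ∼ f → f ∼ a →
                 a ≢ c → a ≢ d → a ≢ e → b ≢ d → b ≢ e → b ≢ f → c ≢ e → c ≢ f → d ≢ f → ⊥
    no-6-cycle ab bc cd de ef fa a≢c a≢d a≢e b≢d b≢e b≢f c≢e c≢f d≢f =
      no-short-cycle _ (_ ∷ _ ∷ _ ∷ _ ∷ _ ∷ []) (ab ∷ bc ∷ cd ∷ de ∷ ef ∷ [-]) fa
        ( (∼⇒≢ ab ∷ a≢c ∷ a≢d ∷ a≢e ∷ ≢-sym (∼⇒≢ fa) ∷ [])
        ∷ (∼⇒≢ bc ∷ b≢d ∷ b≢e ∷ b≢f ∷ [])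
        ∷ (∼⇒≢ cd ∷ c≢e ∷ c≢f ∷ [])
        ∷ (∼⇒≢ de ∷ d≢f ∷ [])
        ∷ (∼⇒≢ ef ∷ [])
        ∷ [] ∷ [])

  module BranchPartition (δ≥2 : MinDegreeAtLeast G 2) (girth : GirthAtLeast G 7) (v : Fin n) where
    open Girth≥7 girth
    open Enumeration (neighbourhood v)
      renaming (elem to u; injective to u-injective; sound to v∼u; complete to u-complete)

    D : ℕ
    D = degree G v

    u-distinct : ∀ {i j} → i ≢ j → u i ≢ u j
    u-distinct i≢j = i≢j ∘ u-injective

    Branch : Fin D → Fin n → Set
    Branch i x = x ≡ u i ⊎ (u i ∼ x × x ≢ v)

    Rest : Fin n → Set
    Rest x = ∀ i → ¬ Branch i x

    u∈Branch : ∀ i → Branch i (u i)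
    u∈Branch i = inj₁ refl

    v∈Rest : Rest v
    v∈Rest i (inj₁ v≡uᵢ)      = ∼⇒≢ (v∼u i) v≡uᵢ
    v∈Rest i (inj₂ (_ , v≢v)) = v≢v refl

    branch-unique : ∀ {i j x} → Branch i x → Branch j x → i ≡ j
    branch-unique (inj₁ x≡uᵢ) (inj₁ x≡uⱼ) = u-injective (trans (sym x≡uᵢ) x≡uⱼ)
    branch-unique {i} {j} (inj₁ refl) (inj₂ (uⱼ∼uᵢ , _)) = ⊥-elim (no-3-cycle (v∼u i) (∼-sym uⱼ∼uᵢ) (∼-sym (v∼u j)))
    branch-unique {i} {j} (inj₂ (uᵢ∼uⱼ , _)) (inj₁ refl) = ⊥-elim (no-3-cycle (v∼u j) (∼-sym uᵢ∼uⱼ) (∼-sym (v∼u i)))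
    branch-unique {i} {j} (inj₂ (uᵢ∼x , x≢v)) (inj₂ (uⱼ∼x , _)) with i ≟ j
    ... | yes i≡j = i≡j
    ... | no i≢j  = ⊥-elim (no-4-cycle (v∼u i) uᵢ∼x (∼-sym uⱼ∼x) (∼-sym (v∼u j)) (≢-sym x≢v) (u-distinct i≢j))

    branch-or-rest : ∀ x → (∃ λ i → Branch i x) ⊎ Rest x
    branch-or-rest x with any? branch?
      where
      branch? : ∀ i → Dec (Branch i x)
      branch? i = (x ≟ u i) ⊎-dec ((adj (u i) x Bool.≟ true) ×-dec ¬? (x ≟ v))
    ... | yes in-branch = inj₁ in-branch
    ... | no ¬in-branch = inj₂ λ i x∈Bᵢ → ¬in-branch (i , x∈Bᵢ)

    outside-Branch∪Rest : ∀ {i j x} → Branch j x → j ≢ i → ¬ (Branch i x ⊎ Rest x)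
    outside-Branch∪Rest x∈Bⱼ j≢i (inj₁ x∈Bᵢ)  = j≢i (branch-unique x∈Bⱼ x∈Bᵢ)
    outside-Branch∪Rest x∈Bⱼ _   (inj₂ x∈R)  = x∈R _ x∈Bⱼ

    beyond-branch-in-Rest : ∀ {j x y} → u j ∼ x → x ≢ v → x ∼ y → y ≢ u j → Rest y
    beyond-branch-in-Rest {j} uⱼ∼x x≢v x∼y y≢uⱼ k (inj₁ refl) with k ≟ j
    ... | yes refl = y≢uⱼ refl
    ... | no k≢j   = no-4-cycle (v∼u j) uⱼ∼x x∼y (∼-sym (v∼u k)) (≢-sym x≢v) (u-distinct (≢-sym k≢j))
    beyond-branch-in-Rest {j} uⱼ∼x x≢v x∼y y≢uⱼ k (inj₂ (uₖ∼y , y≢v)) with k ≟ j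
    ... | yes refl = no-3-cycle uⱼ∼x x∼y (∼-sym uₖ∼y)
    ... | no k≢j   = no-5-cycle (v∼u j) uⱼ∼x x∼y (∼-sym uₖ∼y) (∼-sym (v∼u k))
                       (≢-sym x≢v) (≢-sym y≢v) (≢-sym y≢uⱼ) (u-distinct (≢-sym k≢j))
                       (λ x≡uₖ → k≢j (branch-unique (inj₁ x≡uₖ) (inj₂ (uⱼ∼x , x≢v))))

    Rest-neighbour-in-Branch : ∀ {x y k} → Rest x → x ≢ v → x ∼ y → Branch k y → u k ∼ y × y ≢ v
    Rest-neighbour-in-Branch {k = k} x∈R x≢v x∼y (inj₁ refl) = ⊥-elim (x∈R k (inj₂ (∼-sym x∼y , x≢v)))
    Rest-neighbour-in-Branch                _   _   _   (inj₂ second) = second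

    Rest-no-two-Branch-neighbours : ∀ {x y₁ y₂ k₁ k₂} → Rest x → x ≢ v → x ∼ y₁ → x ∼ y₂ → y₁ ≢ y₂ →
                                    Branch k₁ y₁ → Branch k₂ y₂ → ⊥
    Rest-no-two-Branch-neighbours {k₁ = k₁} {k₂} x∈R x≢v x∼y₁ x∼y₂ y₁≢y₂ y₁∈B y₂∈B
      with Rest-neighbour-in-Branch x∈R x≢v x∼y₁ y₁∈B | Rest-neighbour-in-Branch x∈R x≢v x∼y₂ y₂∈B | k₁ ≟ k₂
    ... | u₁∼y₁ , _ | u₂∼y₂ , _ | yes refl =
      no-4-cycle u₁∼y₁ (∼-sym x∼y₁) x∼y₂ (∼-sym u₂∼y₂) (λ u₁≡x → x∈R k₁ (inj₁ (sym u₁≡x))) y₁≢y₂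
    ... | u₁∼y₁ , y₁≢v | u₂∼y₂ , y₂≢v | no k₁≢k₂ =
      no-6-cycle (v∼u k₁) u₁∼y₁ (∼-sym x∼y₁) x∼y₂ (∼-sym u₂∼y₂) (∼-sym (v∼u k₂))
        (≢-sym y₁≢v) (≢-sym x≢v) (≢-sym y₂≢v)
        (λ u₁≡x → x∈R k₁ (inj₁ (sym u₁≡x)))
        (λ u₁≡y₂ → k₁≢k₂ (branch-unique (inj₁ (sym u₁≡y₂)) y₂∈B))
        (u-distinct k₁≢k₂) y₁≢y₂
        (λ y₁≡u₂ → k₁≢k₂ (branch-unique y₁∈B (inj₁ y₁≡u₂)))
        (λ x≡u₂ → x∈R k₂ (inj₁ x≡u₂))

    Rest-neighbour : ∀ {x} → Rest x → x ≢ v → ∃ λ y → Rest y × x ∼ y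
    Rest-neighbour {x} x∈R x≢v with Enumeration-distinct (neighbourhood x) (δ≥2 x)
    ... | y₁ , y₂ , x∼y₁ , x∼y₂ , y₁≢y₂ with branch-or-rest y₁ | branch-or-rest y₂
    ...   | inj₂ y₁∈R | _         = y₁ , y₁∈R , x∼y₁
    ...   | inj₁ _    | inj₂ y₂∈R = y₂ , y₂∈R , x∼y₂
    ...   | inj₁ (_ , y₁∈B) | inj₁ (_ , y₂∈B) =
      ⊥-elim (Rest-no-two-Branch-neighbours x∈R x≢v x∼y₁ x∼y₂ y₁≢y₂ y₁∈B y₂∈B)

    Branch∪Rest-isTRD : ∀ i → IsTRD G (λ x → Branch i x ⊎ Rest x)
    Branch∪Rest-isTRD i = dominated , total
      where
      S : Fin n → Set
      S x = Branch i x ⊎ Rest x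

      Dominated : Fin n → Set
      Dominated x = (∃ λ y → S y × x ∼ y) × (∃ λ z → ¬ S z × x ∼ z)

      dominated-from-Branch : ∀ {j x} → Branch j x → j ≢ i → Dominated x
      dominated-from-Branch {j} (inj₁ refl) j≢i with another-neighbour δ≥2 (u j) v
      ... | y , uⱼ∼y , y≢v = (v , inj₂ v∈Rest , ∼-sym (v∼u j))
                           , (y , outside-Branch∪Rest (inj₂ (uⱼ∼y , y≢v)) j≢i , uⱼ∼y)
      dominated-from-Branch {j} (inj₂ (uⱼ∼x , x≢v)) j≢i with another-neighbour δ≥2 _ (u j)
      ... | y , x∼y , y≢uⱼ = (y , inj₂ (beyond-branch-in-Rest uⱼ∼x x≢v x∼y y≢uⱼ) , x∼y)
                           , (u j , outside-Branch∪Rest (u∈Branch j) j≢i , ∼-sym uⱼ∼x)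

      dominated : ∀ x → ¬ S x → Dominated x
      dominated x x∉S with branch-or-rest x
      ... | inj₂ x∈R = ⊥-elim (x∉S (inj₂ x∈R))
      ... | inj₁ (j , x∈Bⱼ) with j ≟ i
      ...   | yes refl = ⊥-elim (x∉S (inj₁ x∈Bⱼ))
      ...   | no j≢i   = dominated-from-Branch x∈Bⱼ j≢i

      total : ∀ x → S x → ∃ λ y → S y × x ∼ y
      total _ (inj₁ (inj₁ refl))      = v , inj₂ v∈Rest , ∼-sym (v∼u i)
      total _ (inj₁ (inj₂ (uᵢ∼x , _))) = u i , inj₁ (u∈Branch i) , ∼-sym uᵢ∼x
      total x (inj₂ x∈R) with x ≟ v
      ... | yes refl = u i , inj₁ (u∈Branch i) , v∼u i
      ... | no x≢v with Rest-neighbour x∈R x≢v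
      ...   | y , y∈R , x∼y = y , inj₂ y∈R , x∼y

    Branch-not-isTRD : ∀ i → ¬ IsTRD G (Branch i)
    Branch-not-isTRD i (dominated , _) with another-index (δ≥2 v) i
    ... | j , j≢i with proj₁ (dominated (u j) (j≢i ∘ branch-unique (u∈Branch j)))
    ...   | y , y∈Bᵢ , uⱼ∼y = j≢i (branch-unique (inj₂ (uⱼ∼y , y≢v)) y∈Bᵢ)
      where y≢v = λ { refl → v∈Rest i y∈Bᵢ }

    Rest-not-isTRD : ¬ IsTRD G Rest
    Rest-not-isTRD (_ , total) with total v v∈Rest
    ... | y , y∈R , v∼y with u-complete v∼y
    ...   | k , uₖ≡y = y∈R k (inj₁ (sym uₖ≡y))

    class : Fin n → Fin (suc D)
    class x = [ suc ∘ proj₁ , const zero ] (branch-or-rest x)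

    class≡suc⇔Branch : ∀ {i} x → class x ≡ suc i ⇔ Branch i x
    class≡suc⇔Branch {i} x with branch-or-rest x
    ... | inj₁ (j , x∈Bⱼ) = mk⇔ (λ { refl → x∈Bⱼ }) (cong suc ∘ branch-unique x∈Bⱼ)
    ... | inj₂ x∈R        = mk⇔ (λ ()) (⊥-elim ∘ x∈R i)

    class≡zero⇔Rest : ∀ x → class x ≡ zero ⇔ Rest x
    class≡zero⇔Rest x with branch-or-rest x
    ... | inj₁ (j , x∈Bⱼ) = mk⇔ (λ ()) (λ x∈R → ⊥-elim (x∈R j x∈Bⱼ))
    ... | inj₂ x∈R        = mk⇔ (const x∈R) (const refl)

    class-isTrcPartition : IsTrcPartition G (suc D) class
    class-isTrcPartition = surjective , not-isTRD , coalition
      where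
      surjective : Surjective _≡_ _≡_ class
      surjective zero    = v , λ { refl → from (class≡zero⇔Rest v) v∈Rest }
      surjective (suc i) = u i , λ { refl → from (class≡suc⇔Branch (u i)) (u∈Branch i) }

      not-isTRD : ∀ j → ¬ IsTRD G (λ x → class x ≡ j)
      not-isTRD zero    = Rest-not-isTRD ∘ to (IsTRD-cong G class≡zero⇔Rest)
      not-isTRD (suc i) = Branch-not-isTRD i ∘ to (IsTRD-cong G class≡suc⇔Branch)

      coalition : ∀ j → ∃ λ j′ → j′ ≢ j × IsTRD G (λ x → class x ≡ j ⊎ class x ≡ j′)
      coalition zero = suc i , (λ ()) ,
        from (IsTRD-cong G λ x → ⇔.trans (class≡zero⇔Rest x ⊎-⇔ class≡suc⇔Branch x) (mk⇔ swap swap))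
             (Branch∪Rest-isTRD i)
        where
        i : Fin D
        i = fromℕ< (δ≥2 v)
      coalition (suc i) = zero , (λ ()) ,
        from (IsTRD-cong G λ x → class≡suc⇔Branch x ⊎-⇔ class≡zero⇔Rest x) (Branch∪Rest-isTRD i)

theorem2p8 : ∀ (n : ℕ) (G : Graph n) → Connected G → MinDegreeAtLeast G 2 → GirthAtLeast G 7 → CtrAtLeast G (maxDegree G + 1)
theorem2p8 n G (0<n , _) δ≥2 girth with maxDegree-attained G 0<n
... | v , Δ≤D = suc D , Δ+1≤1+D , class , class-isTrcPartition
  where
  open BranchPartition G δ≥2 girth v
  Δ+1≤1+D : maxDegree G + 1 ≤ suc D
  Δ+1≤1+D = ≤-trans (≤-reflexive (+-comm (maxDegree G) 1)) (s≤s Δ≤D)
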